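{- Let $H$ be a cubic 3-connected planar graph whose vertices are each designated positive or negative, with an even number of negative vertices. Then $H$ has a strong signed edge-labeling if and only if $H$ has a 2-factor $F$ such that every cycle of $F$ contains an even number of positive vertices.
   Context: Let $H$ be a graph whose vertices are each designated positive or negative. For a labeling $c:E(H)\to\{0,a,b\}$ and $x\in\{0,a,b\}$, let $d_x(v)$ be the number of edges incident to $v$ labeled $x$, and let $d_H(v)$ be the degree of $v$. The labeling $c$ is a weak signed edge-labeling of $H$ if for every vertex $v$: $d_0(v)\equiv d_H(v)\pmod 2$; and $d_a(v)\equiv d_b(v)\equiv d_H(v)\pmod 2$ if $v$ is positive, while $d_a(v)\equiv d_b(v)\equiv d_H(v)+1\pmod 2$ if $v$ is negative. A strong signed edge-labeling of $H$ is a weak signed edge-labeling $c$ of $H$ such that additionally $d_0(v)<d_H(v)$ for every vertex $v$ of odd degree. A 2-factor of $H$ is a spanning subgraph in which every vertex has degree 2 (a disjoint union of cycles covering all vertices). -}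

module Defs where

open import Data.Nat using (ℕ; zero; suc; _+_; _*_; _≤_; _<_; _≤ᵇ_; _%_)
open import Data.Fin using (Fin; toℕ) renaming (zero to fzero; suc to fsuc)
open import Data.Fin.Properties using () renaming (_≟_ to _≟F_)
open import Data.Bool using (Bool; true; false; not; _∧_; _∨_; if_then_else_)
open import Data.Product using (_×_; _,_; proj₁; proj₂; Σ; ∃)
open import Data.Sum using (_⊎_)
open import Relation.Binary.PropositionalEquality using (_≡_; _≢_)
open import Relation.Nullary.Decidable using (⌊_⌋)

count : {k : ℕ} → (Fin k → Bool) → ℕ
count {zero}  p = 0
count {suc k} p = (if p fzero then 1 else 0) + count (λ i → p (fsuc i))

allBelow : ℕ → (ℕ → Bool) → Bool
allBelow zero    p = true
allBelow (suc k) p = allBelow k p ∧ p k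

iter : {A : Set} → ℕ → (A → A) → A → A
iter zero    f x = x
iter (suc k) f x = f (iter k f x)

record Graph : Set where
  field
    n    : ℕ
    m    : ℕ
    ends : Fin m → Fin n × Fin n
    loopless : (e : Fin m) → proj₁ (ends e) ≢ proj₂ (ends e)
    simple   : (e f : Fin m) →
               (ends e ≡ ends f ⊎ ends e ≡ (proj₂ (ends f) , proj₁ (ends f))) →
               e ≡ f

open Graph public

Joins : (G : Graph) → Fin (m G) → Fin (n G) → Fin (n G) → Set
Joins G e u w = ends G e ≡ (u , w) ⊎ ends G e ≡ (w , u)

incident : (G : Graph) → Fin (n G) → Fin (m G) → Bool
incident G v e = ⌊ proj₁ (ends G e) ≟F v ⌋ ∨ ⌊ proj₂ (ends G e) ≟F v ⌋

degree : (G : Graph) → Fin (n G) → ℕ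
degree G v = count (incident G v)

degreeIn : (G : Graph) → (Fin (m G) → Bool) → Fin (n G) → ℕ
degreeIn G P v = count (λ e → incident G v e ∧ P e)

Cubic : Graph → Set
Cubic G = (v : Fin (n G)) → degree G v ≡ 3

-- u reaches x using only edges in E and only vertices in V
-- (u itself is not required to lie in V; all later vertices are)
data Reach (G : Graph) (E : Fin (m G) → Bool) (V : Fin (n G) → Bool)
     : Fin (n G) → Fin (n G) → Set where
  here : {u : Fin (n G)} → Reach G E V u u
  step : {u w x : Fin (n G)} (e : Fin (m G)) → E e ≡ true → Joins G e u w →
         V w ≡ true → Reach G E V w x → Reach G E V u x

ThreeConnected : Graph → Set
ThreeConnected G =
  (4 ≤ n G) ×
  ((S : Fin (n G) → Bool) → count S ≤ 2 →
   (u w : Fin (n G)) → S u ≡ false → S w ≡ false →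
   Reach G (λ _ → true) (λ x → not (S x)) u w)

-- Planarity via rotation systems (combinatorial embeddings).
-- A dart is an edge with an orientation; (e , false) starts at
-- proj₁ (ends e), (e , true) starts at proj₂ (ends e).

Dart : Graph → Set
Dart G = Fin (m G) × Bool

tail : (G : Graph) → Dart G → Fin (n G)
tail G (e , false) = proj₁ (ends G e)
tail G (e , true)  = proj₂ (ends G e)

flipD : (G : Graph) → Dart G → Dart G
flipD G (e , b) = (e , not b)

dartKey : (G : Graph) → Dart G → ℕ
dartKey G (e , b) = 2 * toℕ e + (if b then 1 else 0)

record Rotation (G : Graph) : Set where
  field
    σ    : Dart G → Dart G
    σ⁻¹  : Dart G → Dart G
    inv₁ : (d : Dart G) → σ (σ⁻¹ d) ≡ d
    inv₂ : (d : Dart G) → σ⁻¹ (σ d) ≡ d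
    tail-σ : (d : Dart G) → tail G (σ d) ≡ tail G d
    cyclic : (d d′ : Dart G) → tail G d ≡ tail G d′ →
             ∃ λ k → iter k σ d ≡ d′

open Rotation public

facePerm : {G : Graph} → Rotation G → Dart G → Dart G
facePerm {G} R d = σ R (flipD G d)

-- d is the key-minimal element of its face orbit (orbits have length ≤ 2m)
isFaceRep : {G : Graph} → Rotation G → Dart G → Bool
isFaceRep {G} R d =
  allBelow (2 * m G) (λ k → dartKey G d ≤ᵇ dartKey G (iter k (facePerm R) d))

faces : {G : Graph} → Rotation G → ℕ
faces {G} R = count (λ e → isFaceRep R (e , false))
            + count (λ e → isFaceRep R (e , true))

-- Planar (for connected graphs): some rotation system has genus 0,
-- i.e. satisfies Euler's formula  n - m + f = 2.
Planar : Graph → Set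
Planar G = Σ (Rotation G) λ R → n G + faces R ≡ m G + 2

-- true = positive, false = negative
Signing : Graph → Set
Signing G = Fin (n G) → Bool

data Label : Set where
  l0 la lb : Label

isLabel : Label → Label → Bool
isLabel l0 l0 = true
isLabel la la = true
isLabel lb lb = true
isLabel _  _  = false

Labeling : Graph → Set
Labeling G = Fin (m G) → Label

dx : (G : Graph) → Labeling G → Label → Fin (n G) → ℕ
dx G c x = degreeIn G (λ e → isLabel x (c e))

_≡₂_ : ℕ → ℕ → Set
a ≡₂ b = a % 2 ≡ b % 2

WeakSigned : (G : Graph) → Signing G → Labeling G → Set
WeakSigned G s c = (v : Fin (n G)) →
  (dx G c l0 v ≡₂ degree G v) ×
  (dx G c la v ≡₂ (degree G v + (if s v then 0 else 1))) ×
  (dx G c lb v ≡₂ (degree G v + (if s v then 0 else 1)))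

StrongSigned : (G : Graph) → Signing G → Labeling G → Set
StrongSigned G s c = WeakSigned G s c ×
  ((v : Fin (n G)) → degree G v % 2 ≡ 1 → dx G c l0 v < degree G v)

HasStrongSigned : (G : Graph) → Signing G → Set
HasStrongSigned G s = Σ (Labeling G) (StrongSigned G s)

TwoFactor : (G : Graph) → (Fin (m G) → Bool) → Set
TwoFactor G F = (v : Fin (n G)) → degreeIn G F v ≡ 2

-- C is (the vertex set of) a cycle of the 2-factor F: a nonempty vertex
-- set closed under F-edges and connected in F, i.e. a component of F.
IsCycleOf : (G : Graph) → (Fin (m G) → Bool) → (Fin (n G) → Bool) → Set
IsCycleOf G F C =
  (∃ λ v → C v ≡ true) ×
  ((e : Fin (m G)) → F e ≡ true → C (proj₁ (ends G e)) ≡ C (proj₂ (ends G e))) ×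
  ((u w : Fin (n G)) → C u ≡ true → C w ≡ true → Reach G F (λ _ → true) u w)

EvenPositiveTwoFactor : (G : Graph) → Signing G → Set
EvenPositiveTwoFactor G s =
  Σ (Fin (m G) → Bool) λ F → TwoFactor G F ×
    ((C : Fin (n G) → Bool) → IsCycleOf G F C →
       count (λ v → C v ∧ s v) % 2 ≡ 0)

-- In a cubic graph a strong signed labeling has exactly one 0-edge at each
-- vertex (d₀ is odd and less than 3), so the other edges form a 2-factor F
-- in which the a-edges have odd degree exactly at the positive vertices; by
-- the handshake lemma every cycle of F then has an even number of positive
-- vertices. Conversely, labeling the complement of F by 0 and a T-join of F
-- for the positive vertices T by a (the rest of F by b) gives a strong
-- signed labeling, and a T-join exists because T meets every component of F
-- evenly: a defect can always be paired with a second defect of its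
-- component and both removed by toggling the edges of a walk between them.
module Submission where

open import Defs
open import Algebra.Bundles using (CommutativeRing)
open import Data.Bool using (Bool; true; false; not; _∧_; _∨_; _xor_; if_then_else_)
open import Data.Bool.Properties
  using (xor-∧-commutativeRing; xor-assoc; xor-comm; xor-same; xor-identityʳ;
         ∧-distribˡ-xor; ∧-assoc; ∧-comm; ∧-identityʳ; ∧-zeroʳ; ∨-zeroʳ; ¬-not)
  renaming (_≟_ to _≟ᵇ_)
open import Data.Fin using (Fin) renaming (zero to fzero; suc to fsuc)
open import Data.Fin.Properties using (any?; suc-injective) renaming (_≟_ to _≟F_)
open import Data.Nat using (ℕ; zero; suc; _+_; _≤_; _<_; z≤n; s≤s; _%_)
open import Data.Nat.DivMod using (%-distribˡ-+)
open import Data.Nat.Properties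
  using (≤-refl; ≤-trans; <-≤-trans; <-irrefl; ≤-pred; m≤n⇒m≤1+n; m<n⇒m<1+n; +-commutativeSemigroup)
  renaming (suc-injective to ℕ-suc-injective)
open import Data.Product using (∃; _×_; _,_; proj₁; proj₂)
open import Data.Product.Properties using (≡-dec)
open import Data.Sum using (_⊎_; inj₁; inj₂)
open import Function using (_∘_)
open import Function.Bundles using (_⇔_; mk⇔)
open import Relation.Nullary using (Dec; yes; no; contradiction)
open import Relation.Nullary.Decidable using (⌊_⌋; _×-dec_; _⊎-dec_; ¬?; ⌊⌋-map′; dec-true; isYes≗does)
open import Relation.Binary.PropositionalEquality
  using (_≡_; _≢_; refl; sym; trans; cong; cong₂; subst; module ≡-Reasoning)

open import Algebra.Properties.CommutativeSemigroup +-commutativeSemigroup using (interchange)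
open import Algebra.Properties.Semiring.Sum (CommutativeRing.semiring xor-∧-commutativeRing)
  using (∑-comm; ∑-distrib-+; *-distribˡ-sum; sum-cong-≗; sum-replicate-zero)
  renaming (sum to parity)

private
  variable
    k : ℕ
    p q : Fin k → Bool

bit : Bool → ℕ
bit b = if b then 1 else 0

bit-injective : ∀ x y → bit x ≡ bit y → x ≡ y
bit-injective false false _ = refl
bit-injective true  true  _ = refl

⌊⌋-true : ∀ {A : Set} (a? : Dec A) → A → ⌊ a? ⌋ ≡ true
⌊⌋-true a? a = trans (isYes≗does a?) (dec-true a? a)

⌊⌋-sound : ∀ {A : Set} (a? : Dec A) → ⌊ a? ⌋ ≡ true → A
⌊⌋-sound (yes a) _ = a

xor-cancel-middle : ∀ x y z → (x xor y) xor (y xor z) ≡ x xor z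
xor-cancel-middle x y z = begin
  (x xor y) xor (y xor z) ≡⟨ xor-assoc x y (y xor z) ⟩
  x xor (y xor (y xor z)) ≡⟨ cong (x xor_) (sym (xor-assoc y y z)) ⟩
  x xor ((y xor y) xor z) ≡⟨ cong (λ b → x xor (b xor z)) (xor-same y) ⟩
  x xor z                 ∎
  where open ≡-Reasoning

∧-true : ∀ {x y} → x ∧ y ≡ true → x ≡ true × y ≡ true
∧-true {true} {true} _ = refl , refl

∨-true : ∀ x {y} → x ∨ y ≡ true → x ≡ true ⊎ y ≡ true
∨-true true  _ = inj₁ refl
∨-true false h = inj₂ h

xor≡false⇒≡ : ∀ x y → x xor y ≡ false → x ≡ y
xor≡false⇒≡ false false _ = refl
xor≡false⇒≡ true  true  _ = refl

_⊆_ : (Fin k → Bool) → (Fin k → Bool) → Set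
p ⊆ q = ∀ i → p i ≡ true → q i ≡ true

count-cong : (∀ i → p i ≡ q i) → count p ≡ count q
count-cong {zero}  _   = refl
count-cong {suc k} p≗q = cong₂ _+_ (cong bit (p≗q fzero)) (count-cong (p≗q ∘ fsuc))

count-split : (p q : Fin k → Bool) →
  count p ≡ count (λ i → p i ∧ q i) + count (λ i → p i ∧ not (q i))
count-split {zero}  p q = refl
count-split {suc k} p q =
  trans (cong₂ _+_ (bit-split (p fzero) (q fzero)) (count-split (p ∘ fsuc) (q ∘ fsuc)))
        (interchange (bit (p fzero ∧ q fzero)) (bit (p fzero ∧ not (q fzero)))
                     (count (λ i → p (fsuc i) ∧ q (fsuc i))) (count (λ i → p (fsuc i) ∧ not (q (fsuc i)))))
  where
  bit-split : ∀ x y → bit x ≡ bit (x ∧ y) + bit (x ∧ not y)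
  bit-split true  true  = refl
  bit-split true  false = refl
  bit-split false _     = refl

count≤ : (p : Fin k → Bool) → count p ≤ k
count≤ {zero}  p = z≤n
count≤ {suc k} p with p fzero
... | true  = s≤s (count≤ (p ∘ fsuc))
... | false = m≤n⇒m≤1+n (count≤ (p ∘ fsuc))

count-pos : (i : Fin k) → p i ≡ true → 0 < count p
count-pos {p = p} fzero pi rewrite pi = s≤s z≤n
count-pos {p = p} (fsuc i) pi with p fzero
... | true  = s≤s z≤n
... | false = count-pos i pi

count-mono : p ⊆ q → count p ≤ count q
count-mono {zero}          p⊆q = z≤n
count-mono {suc k} {p} {q} p⊆q with p fzero in p0 | q fzero in q0
... | false | false = count-mono (p⊆q ∘ fsuc)
... | false | true  = m≤n⇒m≤1+n (count-mono (p⊆q ∘ fsuc))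
... | true  | true  = s≤s (count-mono (p⊆q ∘ fsuc))
... | true  | false = contradiction (trans (sym q0) (p⊆q fzero p0)) λ ()

count-< : p ⊆ q → (i : Fin k) → p i ≡ false → q i ≡ true → count p < count q
count-< {p = p} {q} p⊆q fzero pi qi rewrite pi | qi = s≤s (count-mono (p⊆q ∘ fsuc))
count-< {p = p} {q} p⊆q (fsuc i) pi qi with p fzero in p0 | q fzero in q0
... | false | false = count-< (p⊆q ∘ fsuc) i pi qi
... | false | true  = m<n⇒m<1+n (count-< (p⊆q ∘ fsuc) i pi qi)
... | true  | true  = s≤s (count-< (p⊆q ∘ fsuc) i pi qi)
... | true  | false = contradiction (trans (sym q0) (p⊆q fzero p0)) λ ()

count-xor-pair< : ∀ {a b} → a ≢ b → p a ≡ true → p b ≡ true →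
  count (λ i → p i xor (⌊ a ≟F i ⌋ xor ⌊ b ≟F i ⌋)) < count p
count-xor-pair< {p = p} {a} {b} a≢b pa pb = count-< removed⊆ a a-removed pa
  where
  removed⊆ : (λ i → p i xor (⌊ a ≟F i ⌋ xor ⌊ b ≟F i ⌋)) ⊆ p
  removed⊆ i h with a ≟F i | b ≟F i
  ... | yes refl | _        = pa
  ... | no _     | yes refl = pb
  ... | no _     | no _     = trans (sym (xor-identityʳ (p i))) h
  a-removed : p a xor (⌊ a ≟F a ⌋ xor ⌊ b ≟F a ⌋) ≡ false
  a-removed with a ≟F a | b ≟F a
  ... | no a≢a | _       = contradiction refl a≢a
  ... | yes _  | yes b≡a = contradiction (sym b≡a) a≢b
  ... | yes _  | no _    = cong (_xor true) pa

-- Parity, i.e. sums in the field (Bool, xor, ∧)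

count-%2 : (p : Fin k → Bool) → count p % 2 ≡ bit (parity p)
count-%2 {zero}  p = refl
count-%2 {suc k} p = begin
  (bit (p fzero) + count (p ∘ fsuc)) % 2
    ≡⟨ %-distribˡ-+ (bit (p fzero)) (count (p ∘ fsuc)) 2 ⟩
  (bit (p fzero) % 2 + count (p ∘ fsuc) % 2) % 2
    ≡⟨ cong (λ r → (bit (p fzero) % 2 + r) % 2) (count-%2 (p ∘ fsuc)) ⟩
  (bit (p fzero) % 2 + bit (parity (p ∘ fsuc))) % 2
    ≡⟨ bit-xor (p fzero) (parity (p ∘ fsuc)) ⟩
  bit (p fzero xor parity (p ∘ fsuc)) ∎
  where
  open ≡-Reasoning
  bit-xor : ∀ x y → (bit x % 2 + bit y) % 2 ≡ bit (x xor y)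
  bit-xor false false = refl
  bit-xor false true  = refl
  bit-xor true  false = refl
  bit-xor true  true  = refl

parity-single : (p : Fin k → Bool) (a : Fin k) → parity (λ i → p i ∧ ⌊ a ≟F i ⌋) ≡ p a
parity-single {suc k} p fzero =
  trans (cong₂ _xor_ (∧-identityʳ (p fzero))
                     (trans (sum-cong-≗ (∧-zeroʳ ∘ p ∘ fsuc)) (sum-replicate-zero k)))
        (xor-identityʳ (p fzero))
parity-single {suc k} p (fsuc a) =
  cong₂ _xor_ (∧-zeroʳ (p fzero))
    (trans (sum-cong-≗ λ i → cong (p (fsuc i) ∧_) (⌊⌋-map′ (cong fsuc) suc-injective (a ≟F i)))
           (parity-single (p ∘ fsuc) a))

parity≡false⇒another : ∀ {a} → parity p ≡ false → p a ≡ true → ∃ λ b → b ≢ a × p b ≡ true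
parity≡false⇒another {p = p} {a} even pa
  with any? (λ b → ¬? (b ≟F a) ×-dec (p b ≟ᵇ true))
... | yes found = found
... | no none   = contradiction (begin
  true                            ≡⟨ pa ⟨
  p a                             ≡⟨ parity-single p a ⟨
  parity (λ i → p i ∧ ⌊ a ≟F i ⌋) ≡⟨ sum-cong-≗ only-at-a ⟩
  parity p                        ≡⟨ even ⟩
  false                           ∎) λ ()
  where
  open ≡-Reasoning
  only-at-a : ∀ i → p i ∧ ⌊ a ≟F i ⌋ ≡ p i
  only-at-a i with a ≟F i | p i in pi
  ... | yes _  | _     = ∧-identityʳ _
  ... | no _   | false = refl
  ... | no a≢i | true  = contradiction (i , a≢i ∘ sym , pi) none

module _ (G : Graph) where

  Walk : (Fin (m G) → Bool) → Fin (n G) → Fin (n G) → Set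
  Walk E = Reach G E (λ _ → true)

  joins-sym : ∀ {e u w} → Joins G e u w → Joins G e w u
  joins-sym (inj₁ eq) = inj₂ eq
  joins-sym (inj₂ eq) = inj₁ eq

  joins? : ∀ e u w → Dec (Joins G e u w)
  joins? e u w = ≡-dec _≟F_ _≟F_ (ends G e) (u , w) ⊎-dec ≡-dec _≟F_ _≟F_ (ends G e) (w , u)

  module _ {E : Fin (m G) → Bool} where

    walk-snoc : ∀ {u w x e} → Walk E u w → E e ≡ true → Joins G e w x → Walk E u x
    walk-snoc here                      Ee j = step _ Ee j refl here
    walk-snoc (step e′ Ee′ j′ _ rest) Ee j = step e′ Ee′ j′ refl (walk-snoc rest Ee j)

    walk-reverse : ∀ {u w} → Walk E u w → Walk E w u
    walk-reverse here                  = here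
    walk-reverse (step e Ee j _ rest) = walk-snoc (walk-reverse rest) Ee (joins-sym j)

    walk-append : ∀ {u w x} → Walk E u w → Walk E w x → Walk E u x
    walk-append here                   rest′ = rest′
    walk-append (step e Ee j _ rest) rest′ = step e Ee j refl (walk-append rest rest′)

-- Components, as stabilised balls

module Component (G : Graph) (F : Fin (m G) → Bool) (d : Fin (n G)) where

  AdjacentTo : (Fin (n G) → Bool) → Fin (n G) → Set
  AdjacentTo X u = ∃ λ e → F e ≡ true × ∃ λ w → Joins G e w u × X w ≡ true

  adjacentTo? : ∀ X u → Dec (AdjacentTo X u)
  adjacentTo? X u = any? λ e → (F e ≟ᵇ true) ×-dec any? λ w → joins? G e w u ×-dec (X w ≟ᵇ true)

  ball : ℕ → Fin (n G) → Bool
  ball zero    u = ⌊ d ≟F u ⌋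
  ball (suc r) u = ball r u ∨ ⌊ adjacentTo? (ball r) u ⌋

  ball-walk : ∀ r u → ball r u ≡ true → Walk G F d u
  ball-walk zero u h = subst (Walk G F d) (⌊⌋-sound (d ≟F u) h) here
  ball-walk (suc r) u h with ∨-true (ball r u) h
  ... | inj₁ inBall = ball-walk r u inBall
  ... | inj₂ adjacent with ⌊⌋-sound (adjacentTo? (ball r) u) adjacent
  ...   | e , Fe , w , j , inX = walk-snoc G (ball-walk r w inX) Fe j

  ball-grows : ∀ r → ball r ⊆ ball (suc r)
  ball-grows r u h rewrite h = refl

  ball-adjacent : ∀ r {e} → F e ≡ true → ∀ {w u} → Joins G e w u → ball r w ≡ true → ball (suc r) u ≡ true
  ball-adjacent r Fe j h =
    trans (cong (ball r _ ∨_) (⌊⌋-true (adjacentTo? (ball r) _) (_ , Fe , _ , j , h))) (∨-zeroʳ _)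

  ball-∋ : ∀ r → ball r d ≡ true
  ball-∋ zero    = ⌊⌋-true (d ≟F d) refl
  ball-∋ (suc r) = ball-grows r d (ball-∋ r)

  Stable : ℕ → Set
  Stable r = ball (suc r) ⊆ ball r

  stable-or-large : ∀ r → ∃ Stable ⊎ r < count (ball r)
  stable-or-large zero = inj₂ (count-pos d (ball-∋ zero))
  stable-or-large (suc r) with stable-or-large r
  ... | inj₁ stable = inj₁ stable
  ... | inj₂ large with any? (λ u → (ball (suc r) u ≟ᵇ true) ×-dec (ball r u ≟ᵇ false))
  ...   | yes (u , new , old) = inj₂ (≤-trans (s≤s large) (count-< (ball-grows r) u old new))
  ...   | no none             = inj₁ (r , no-new)
    where
    no-new : Stable r
    no-new u h = ¬-not λ old → none (u , h , old)

  stable : ∃ Stable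
  stable with stable-or-large (n G)
  ... | inj₁ s     = s
  ... | inj₂ large = contradiction (<-≤-trans large (count≤ (ball (n G)))) (<-irrefl refl)

  component : Fin (n G) → Bool
  component = ball (proj₁ stable)

  component-∋ : component d ≡ true
  component-∋ = ball-∋ (proj₁ stable)

  component-walk : ∀ u → component u ≡ true → Walk G F d u
  component-walk = ball-walk (proj₁ stable)

  component-closed : ∀ e → F e ≡ true →
    component (proj₁ (ends G e)) ≡ component (proj₂ (ends G e))
  component-closed e Fe with component (proj₁ (ends G e)) in a∈ | component (proj₂ (ends G e)) in b∈
  ... | true  | true  = refl
  ... | false | false = refl
  ... | true  | false =
    contradiction (trans (sym b∈) (proj₂ stable _ (ball-adjacent (proj₁ stable) Fe (inj₁ refl) a∈))) λ ()
  ... | false | true  =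
    contradiction (trans (sym a∈) (proj₂ stable _ (ball-adjacent (proj₁ stable) Fe (inj₂ refl) b∈))) λ ()

  component-isCycle : IsCycleOf G F component
  component-isCycle =
    (d , component-∋) , component-closed ,
    λ u w u∈ w∈ → walk-append G (walk-reverse G (component-walk u u∈)) (component-walk w w∈)

module _ (G : Graph) where

  oddDegree : (Fin (m G) → Bool) → Fin (n G) → Bool
  oddDegree J v = parity (λ e → incident G v e ∧ J e)

  toggle : (Fin (m G) → Bool) → Fin (m G) → Fin (m G) → Bool
  toggle J e f = J f xor ⌊ e ≟F f ⌋

  incident-ends : ∀ e v → incident G v e ≡ ⌊ proj₁ (ends G e) ≟F v ⌋ xor ⌊ proj₂ (ends G e) ≟F v ⌋
  incident-ends e v with proj₁ (ends G e) ≟F v | proj₂ (ends G e) ≟F v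
  ... | yes a≡v | yes b≡v = contradiction (trans a≡v (sym b≡v)) (loopless G e)
  ... | yes _   | no _    = refl
  ... | no _    | _       = refl

  incident-joins : ∀ {e u w} → Joins G e u w → ∀ v → incident G v e ≡ ⌊ u ≟F v ⌋ xor ⌊ w ≟F v ⌋
  incident-joins {e} {u} {w} j v = trans (incident-ends e v) (from-joins j)
    where
    ends-indicator : Fin (n G) × Fin (n G) → Bool
    ends-indicator (a , b) = ⌊ a ≟F v ⌋ xor ⌊ b ≟F v ⌋
    from-joins : Joins G e u w → ends-indicator (ends G e) ≡ ⌊ u ≟F v ⌋ xor ⌊ w ≟F v ⌋
    from-joins (inj₁ eq) = cong ends-indicator eq
    from-joins (inj₂ eq) = trans (cong ends-indicator eq) (xor-comm ⌊ w ≟F v ⌋ ⌊ u ≟F v ⌋)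

  parity-incident : ∀ (C : Fin (n G) → Bool) e →
    parity (λ v → C v ∧ incident G v e) ≡ C (proj₁ (ends G e)) xor C (proj₂ (ends G e))
  parity-incident C e = begin
    parity (λ v → C v ∧ incident G v e)
      ≡⟨ sum-cong-≗ (λ v → trans (cong (C v ∧_) (incident-ends e v)) (∧-distribˡ-xor (C v) _ _)) ⟩
    parity (λ v → (C v ∧ ⌊ a ≟F v ⌋) xor (C v ∧ ⌊ b ≟F v ⌋))
      ≡⟨ ∑-distrib-+ (λ v → C v ∧ ⌊ a ≟F v ⌋) (λ v → C v ∧ ⌊ b ≟F v ⌋) ⟩
    parity (λ v → C v ∧ ⌊ a ≟F v ⌋) xor parity (λ v → C v ∧ ⌊ b ≟F v ⌋)
      ≡⟨ cong₂ _xor_ (parity-single C a) (parity-single C b) ⟩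
    C a xor C b ∎
    where
    open ≡-Reasoning
    a = proj₁ (ends G e)
    b = proj₂ (ends G e)

  -- Counting the pairs (v , e) with v ∈ C incident to e ∈ J edge by edge:
  -- every edge of J has either both or no endpoints in C.
  handshake : ∀ J (C : Fin (n G) → Bool) →
    (∀ e → J e ≡ true → C (proj₁ (ends G e)) ≡ C (proj₂ (ends G e))) →
    parity (λ v → C v ∧ oddDegree J v) ≡ false
  handshake J C closed = begin
    parity (λ v → C v ∧ oddDegree J v)
      ≡⟨ sum-cong-≗ (λ v → *-distribˡ-sum (C v) (λ e → incident G v e ∧ J e)) ⟩
    parity (λ v → parity (λ e → C v ∧ (incident G v e ∧ J e)))
      ≡⟨ ∑-comm (λ v e → C v ∧ (incident G v e ∧ J e)) ⟩
    parity (λ e → parity (λ v → C v ∧ (incident G v e ∧ J e)))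
      ≡⟨ sum-cong-≗ edge-contribution ⟩
    parity {m G} (λ _ → false)
      ≡⟨ sum-replicate-zero (m G) ⟩
    false ∎
    where
    open ≡-Reasoning
    closed-edge : ∀ e → J e ∧ (C (proj₁ (ends G e)) xor C (proj₂ (ends G e))) ≡ false
    closed-edge e with J e in Je
    ... | false = refl
    ... | true  = trans (cong (_xor C (proj₂ (ends G e))) (closed e Je)) (xor-same (C (proj₂ (ends G e))))
    edge-contribution : ∀ e → parity (λ v → C v ∧ (incident G v e ∧ J e)) ≡ false
    edge-contribution e = begin
      parity (λ v → C v ∧ (incident G v e ∧ J e))
        ≡⟨ sum-cong-≗ (λ v → trans (sym (∧-assoc (C v) (incident G v e) (J e))) (∧-comm (C v ∧ incident G v e) (J e))) ⟩
      parity (λ v → J e ∧ (C v ∧ incident G v e))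
        ≡⟨ *-distribˡ-sum (J e) (λ v → C v ∧ incident G v e) ⟨
      J e ∧ parity (λ v → C v ∧ incident G v e)
        ≡⟨ cong (J e ∧_) (parity-incident C e) ⟩
      J e ∧ (C (proj₁ (ends G e)) xor C (proj₂ (ends G e)))
        ≡⟨ closed-edge e ⟩
      false ∎

  oddDegree-toggle : ∀ J {e u w} → Joins G e u w → ∀ v →
    oddDegree (toggle J e) v ≡ oddDegree J v xor (⌊ u ≟F v ⌋ xor ⌊ w ≟F v ⌋)
  oddDegree-toggle J {e} {u} {w} j v = begin
    parity (λ f → incident G v f ∧ (J f xor ⌊ e ≟F f ⌋))
      ≡⟨ sum-cong-≗ (λ f → ∧-distribˡ-xor (incident G v f) (J f) _) ⟩
    parity (λ f → (incident G v f ∧ J f) xor (incident G v f ∧ ⌊ e ≟F f ⌋))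
      ≡⟨ ∑-distrib-+ (λ f → incident G v f ∧ J f) (λ f → incident G v f ∧ ⌊ e ≟F f ⌋) ⟩
    oddDegree J v xor parity (λ f → incident G v f ∧ ⌊ e ≟F f ⌋)
      ≡⟨ cong (oddDegree J v xor_) (parity-single (incident G v) e) ⟩
    oddDegree J v xor incident G v e
      ≡⟨ cong (oddDegree J v xor_) (incident-joins {e} {u} {w} j v) ⟩
    oddDegree J v xor (⌊ u ≟F v ⌋ xor ⌊ w ≟F v ⌋) ∎
    where open ≡-Reasoning

  toggle-⊆ : ∀ {E J e} → J ⊆ E → E e ≡ true → toggle J e ⊆ E
  toggle-⊆ {J = J} {e} J⊆E Ee f h with e ≟F f
  ... | yes refl = Ee
  ... | no _     = J⊆E f (trans (sym (xor-identityʳ (J f))) h)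

  walk-toggle : ∀ {E V u t} → Reach G E V u t → ∀ {J} → J ⊆ E →
    ∃ λ J′ → J′ ⊆ E × (∀ v → oddDegree J′ v ≡ oddDegree J v xor (⌊ u ≟F v ⌋ xor ⌊ t ≟F v ⌋))
  walk-toggle {u = u} here {J} J⊆E =
    J , J⊆E , λ v → sym (trans (cong (oddDegree J v xor_) (xor-same ⌊ u ≟F v ⌋)) (xor-identityʳ _))
  walk-toggle {u = u} {t} (step {w = w} e Ee j _ rest) {J} J⊆E
    with walk-toggle rest (toggle-⊆ J⊆E Ee)
  ... | J′ , J′⊆E , toggled = J′ , J′⊆E , λ v → begin
    oddDegree J′ v
      ≡⟨ toggled v ⟩
    oddDegree (toggle J e) v xor (⌊ w ≟F v ⌋ xor ⌊ t ≟F v ⌋)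
      ≡⟨ cong (_xor (⌊ w ≟F v ⌋ xor ⌊ t ≟F v ⌋)) (oddDegree-toggle J {e} {u} {w} j v) ⟩
    (oddDegree J v xor (⌊ u ≟F v ⌋ xor ⌊ w ≟F v ⌋)) xor (⌊ w ≟F v ⌋ xor ⌊ t ≟F v ⌋)
      ≡⟨ xor-assoc (oddDegree J v) (⌊ u ≟F v ⌋ xor ⌊ w ≟F v ⌋) (⌊ w ≟F v ⌋ xor ⌊ t ≟F v ⌋) ⟩
    oddDegree J v xor ((⌊ u ≟F v ⌋ xor ⌊ w ≟F v ⌋) xor (⌊ w ≟F v ⌋ xor ⌊ t ≟F v ⌋))
      ≡⟨ cong (oddDegree J v xor_) (xor-cancel-middle ⌊ u ≟F v ⌋ ⌊ w ≟F v ⌋ ⌊ t ≟F v ⌋) ⟩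
    oddDegree J v xor (⌊ u ≟F v ⌋ xor ⌊ t ≟F v ⌋) ∎
    where open ≡-Reasoning

  module _ (F : Fin (m G) → Bool) (T : Fin (n G) → Bool)
           (even : ∀ C → IsCycleOf G F C → parity (λ v → C v ∧ T v) ≡ false) where

    defects : (Fin (m G) → Bool) → Fin (n G) → Bool
    defects J v = oddDegree J v xor T v

    defects-even-in-component : ∀ {J} → J ⊆ F → ∀ d →
      parity (λ v → Component.component G F d v ∧ defects J v) ≡ false
    defects-even-in-component {J} J⊆F d = begin
      parity (λ v → C v ∧ (oddDegree J v xor T v))
        ≡⟨ sum-cong-≗ (λ v → ∧-distribˡ-xor (C v) (oddDegree J v) (T v)) ⟩
      parity (λ v → (C v ∧ oddDegree J v) xor (C v ∧ T v))
        ≡⟨ ∑-distrib-+ (λ v → C v ∧ oddDegree J v) (λ v → C v ∧ T v) ⟩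
      parity (λ v → C v ∧ oddDegree J v) xor parity (λ v → C v ∧ T v)
        ≡⟨ cong₂ _xor_ (handshake J C (λ e → component-closed e ∘ J⊆F e)) (even C component-isCycle) ⟩
      false ∎
      where
      open ≡-Reasoning
      open Component G F d
      C = component

    defect-partner : ∀ {J} → J ⊆ F → ∀ d → defects J d ≡ true →
      ∃ λ d′ → d′ ≢ d × Walk G F d d′ × defects J d′ ≡ true
    defect-partner {J} J⊆F d dD
      with parity≡false⇒another (defects-even-in-component J⊆F d)
             (trans (cong (_∧ defects J d) (Component.component-∋ G F d)) dD)
    ... | d′ , d′≢d , d′∈
      = d′ , d′≢d , Component.component-walk G F d d′ (proj₁ (∧-true d′∈)) , proj₂ (∧-true d′∈)

    fewer-defects : ∀ {J} → J ⊆ F → ∀ d → defects J d ≡ true →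
      ∃ λ J′ → J′ ⊆ F × count (defects J′) < count (defects J)
    fewer-defects {J} J⊆F d dD with defect-partner J⊆F d dD
    ... | d′ , d′≢d , walk , d′D with walk-toggle walk J⊆F
    ...   | J′ , J′⊆F , toggled =
      J′ , J′⊆F ,
      subst (_< count (defects J)) (count-cong (sym ∘ moved)) (count-xor-pair< (d′≢d ∘ sym) dD d′D)
      where
      moved : ∀ v → defects J′ v ≡ defects J v xor (⌊ d ≟F v ⌋ xor ⌊ d′ ≟F v ⌋)
      moved v = begin
        oddDegree J′ v xor T v                 ≡⟨ cong (_xor T v) (toggled v) ⟩
        (oddDegree J v xor pair) xor T v       ≡⟨ xor-assoc (oddDegree J v) pair (T v) ⟩
        oddDegree J v xor (pair xor T v)       ≡⟨ cong (oddDegree J v xor_) (xor-comm pair (T v)) ⟩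
        oddDegree J v xor (T v xor pair)       ≡⟨ xor-assoc (oddDegree J v) (T v) pair ⟨
        (oddDegree J v xor T v) xor pair       ∎
        where
        open ≡-Reasoning
        pair = ⌊ d ≟F v ⌋ xor ⌊ d′ ≟F v ⌋

    T-join-fuel : ∀ r J → J ⊆ F → count (defects J) ≤ r →
      ∃ λ J′ → J′ ⊆ F × (∀ v → oddDegree J′ v ≡ T v)
    T-join-fuel r J J⊆F bound with any? (λ v → defects J v ≟ᵇ true) | r
    ... | no none       | _ = J , J⊆F , λ v → xor≡false⇒≡ _ _ (¬-not λ dD → none (v , dD))
    ... | yes (d , dD)  | zero =
      contradiction (≤-trans (count-pos d dD) bound) λ ()
    ... | yes (d , dD)  | suc r′ with fewer-defects J⊆F d dD
    ...   | J′ , J′⊆F , fewer = T-join-fuel r′ J′ J′⊆F (≤-pred (≤-trans fewer bound))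

    T-join : ∃ λ J → J ⊆ F × (∀ v → oddDegree J v ≡ T v)
    T-join = T-join-fuel _ (λ _ → false) (λ _ ()) ≤-refl

odd<3⇒≡1 : ∀ a → a < 3 → a % 2 ≡ 1 → a ≡ 1
odd<3⇒≡1 1 _ _ = refl
odd<3⇒≡1 0 _ ()
odd<3⇒≡1 2 _ ()
odd<3⇒≡1 (suc (suc (suc _))) (s≤s (s≤s (s≤s ()))) _

+≡2⇒≡₂ : ∀ a b → a + b ≡ 2 → b ≡₂ a
+≡2⇒≡₂ 0 _ refl = refl
+≡2⇒≡₂ 1 _ refl = refl
+≡2⇒≡₂ 2 _ refl = refl
+≡2⇒≡₂ (suc (suc (suc _))) _ ()

degreeIn-split : ∀ G (P Q : Fin (m G) → Bool) v →
  degreeIn G P v ≡ degreeIn G (λ e → P e ∧ Q e) v + degreeIn G (λ e → P e ∧ not (Q e)) v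
degreeIn-split G P Q v =
  trans (count-split (λ e → incident G v e ∧ P e) Q)
        (cong₂ _+_ (count-cong λ e → ∧-assoc (incident G v e) (P e) (Q e))
                   (count-cong λ e → ∧-assoc (incident G v e) (P e) (not (Q e))))

degreeIn-cong : ∀ G {P Q : Fin (m G) → Bool} → (∀ e → P e ≡ Q e) → ∀ v →
  degreeIn G P v ≡ degreeIn G Q v
degreeIn-cong G P≗Q v = count-cong λ e → cong (incident G v e ∧_) (P≗Q e)

signed-parity : ∀ b → (3 + (if b then 0 else 1)) % 2 ≡ bit b
signed-parity true  = refl
signed-parity false = refl

signed-cubic-vertex : ∀ b {d₀ dₐ d_b} → d₀ ≡ 1 → dₐ % 2 ≡ bit b → dₐ + d_b ≡ 2 →
  (d₀ ≡₂ 3) × (dₐ ≡₂ (3 + (if b then 0 else 1))) × (d_b ≡₂ (3 + (if b then 0 else 1)))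
signed-cubic-vertex b {dₐ = dₐ} {d_b} refl a-odd a+b≡2 =
  refl , a≡₂ , trans (+≡2⇒≡₂ dₐ d_b a+b≡2) a≡₂
  where
  a≡₂ = trans a-odd (sym (signed-parity b))

module _ (H : Graph) (cubic : Cubic H) (s : Signing H) where

  strongSigned⇒evenPositiveTwoFactor : HasStrongSigned H s → EvenPositiveTwoFactor H s
  strongSigned⇒evenPositiveTwoFactor (c , weak , strong) = F , twoFactor , evenCycles
    where
    open ≡-Reasoning
    F A : Fin (m H) → Bool
    F e = not (isLabel l0 (c e))
    A e = isLabel la (c e)

    A⊆F : A ⊆ F
    A⊆F e h with c e
    ... | la = refl

    one-zero-edge : ∀ v → dx H c l0 v ≡ 1
    one-zero-edge v =
      odd<3⇒≡1 _ (subst (dx H c l0 v <_) (cubic v) (strong v (cong (_% 2) (cubic v))))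
                 (trans (proj₁ (weak v)) (cong (_% 2) (cubic v)))

    twoFactor : TwoFactor H F
    twoFactor v = sym (ℕ-suc-injective (begin
      3                                  ≡⟨ cubic v ⟨
      degree H v                         ≡⟨ count-split (incident H v) (λ e → isLabel l0 (c e)) ⟩
      dx H c l0 v + degreeIn H F v       ≡⟨ cong (_+ degreeIn H F v) (one-zero-edge v) ⟩
      1 + degreeIn H F v                 ∎))

    oddDegree-A : ∀ v → oddDegree H A v ≡ s v
    oddDegree-A v = bit-injective _ _ (begin
      bit (oddDegree H A v)                  ≡⟨ count-%2 (λ e → incident H v e ∧ A e) ⟨
      dx H c la v % 2                        ≡⟨ proj₁ (proj₂ (weak v)) ⟩
      (degree H v + (if s v then 0 else 1)) % 2
        ≡⟨ cong (λ d → (d + (if s v then 0 else 1)) % 2) (cubic v) ⟩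
      (3 + (if s v then 0 else 1)) % 2       ≡⟨ signed-parity (s v) ⟩
      bit (s v)                              ∎)

    evenCycles : ∀ C → IsCycleOf H F C → count (λ v → C v ∧ s v) % 2 ≡ 0
    evenCycles C (_ , closed , _) = begin
      count (λ v → C v ∧ s v) % 2                 ≡⟨ count-%2 (λ v → C v ∧ s v) ⟩
      bit (parity (λ v → C v ∧ s v))
        ≡⟨ cong bit (sum-cong-≗ λ v → cong (C v ∧_) (sym (oddDegree-A v))) ⟩
      bit (parity (λ v → C v ∧ oddDegree H A v))
        ≡⟨ cong bit (handshake H A C (λ e → closed e ∘ A⊆F e)) ⟩
      0                                           ∎

  labeling : (F J : Fin (m H) → Bool) → Labeling H
  labeling F J e = if F e then (if J e then la else lb) else l0

  labeling-strong : ∀ {F J} → TwoFactor H F → J ⊆ F → (∀ v → oddDegree H J v ≡ s v) →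
    StrongSigned H s (labeling F J)
  labeling-strong {F} {J} twoFactor J⊆F J-odd = weak , strong
    where
    open ≡-Reasoning
    c = labeling F J

    zero-edges : ∀ e → isLabel l0 (c e) ≡ not (F e)
    zero-edges e with F e | J e
    ... | true  | true  = refl
    ... | true  | false = refl
    ... | false | _     = refl

    a-edges : ∀ e → isLabel la (c e) ≡ F e ∧ J e
    a-edges e with F e | J e
    ... | true  | true  = refl
    ... | true  | false = refl
    ... | false | _     = refl

    b-edges : ∀ e → isLabel lb (c e) ≡ F e ∧ not (J e)
    b-edges e with F e | J e
    ... | true  | true  = refl
    ... | true  | false = refl
    ... | false | _     = refl

    J-within-F : ∀ e → F e ∧ J e ≡ J e
    J-within-F e with J e in Je
    ... | false = ∧-zeroʳ (F e)
    ... | true  = trans (∧-identityʳ (F e)) (J⊆F e Je)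

    one-zero-edge : ∀ v → dx H c l0 v ≡ 1
    one-zero-edge v = sym (ℕ-suc-injective (ℕ-suc-injective (begin
      3                                         ≡⟨ cubic v ⟨
      degree H v                                ≡⟨ count-split (incident H v) F ⟩
      degreeIn H F v + degreeIn H (not ∘ F) v
        ≡⟨ cong₂ _+_ (twoFactor v) (sym (degreeIn-cong H zero-edges v)) ⟩
      2 + dx H c l0 v                           ∎)))

    a-parity : ∀ v → dx H c la v % 2 ≡ bit (s v)
    a-parity v = begin
      dx H c la v % 2
        ≡⟨ cong (_% 2) (degreeIn-cong H (λ e → trans (a-edges e) (J-within-F e)) v) ⟩
      degreeIn H J v % 2                        ≡⟨ count-%2 (λ e → incident H v e ∧ J e) ⟩
      bit (oddDegree H J v)                     ≡⟨ cong bit (J-odd v) ⟩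
      bit (s v)                                 ∎

    a+b≡2 : ∀ v → dx H c la v + dx H c lb v ≡ 2
    a+b≡2 v = begin
      dx H c la v + dx H c lb v
        ≡⟨ cong₂ _+_ (degreeIn-cong H a-edges v) (degreeIn-cong H b-edges v) ⟩
      degreeIn H (λ e → F e ∧ J e) v + degreeIn H (λ e → F e ∧ not (J e)) v
        ≡⟨ degreeIn-split H F J v ⟨
      degreeIn H F v
        ≡⟨ twoFactor v ⟩
      2 ∎

    weak : WeakSigned H s c
    weak v rewrite cubic v =
      signed-cubic-vertex (s v) {dₐ = dx H c la v} {d_b = dx H c lb v}
        (one-zero-edge v) (a-parity v) (a+b≡2 v)

    strong : ∀ v → degree H v % 2 ≡ 1 → dx H c l0 v < degree H v
    strong v _ rewrite cubic v | one-zero-edge v = s≤s (s≤s z≤n)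

  evenPositiveTwoFactor⇒strongSigned : EvenPositiveTwoFactor H s → HasStrongSigned H s
  evenPositiveTwoFactor⇒strongSigned (F , twoFactor , evenCycles)
    with T-join H F s (λ C cyc → bit-injective _ false
                         (trans (sym (count-%2 (λ v → C v ∧ s v))) (evenCycles C cyc)))
  ... | J , J⊆F , J-odd = labeling F J , labeling-strong twoFactor J⊆F J-odd

corollary1 : (H : Graph) → Cubic H → ThreeConnected H → Planar H →
    (s : Signing H) → count (λ v → not (s v)) % 2 ≡ 0 →
    HasStrongSigned H s ⇔ EvenPositiveTwoFactor H s
corollary1 H cubic _ _ s _ =
  mk⇔ (strongSigned⇒evenPositiveTwoFactor H cubic s) (evenPositiveTwoFactor⇒strongSigned H cubic s)
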